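{- Let $d\geq 1$ and $k\geq 2$ be integers. Then for all sufficiently large $n$, there exists a linear nearly-$d$-regular $k$-uniform hypergraph on $n$ vertices.
   Context: A $k$-uniform hypergraph has edges that are $k$-element subsets of its vertex set, with no repeated edges. It is linear if any two distinct edges share at most one vertex. The degree of a vertex is the number of edges containing it. A $k$-uniform hypergraph is nearly-$d$-regular if every vertex has degree $d$ or $d-1$, and fewer than $k$ vertices have degree $d-1$. -}

module Defs where

open import Data.Nat using (ℕ; zero; suc; _+_; _∸_; _≤_; _<_)
open import Data.Fin using (Fin; zero; suc)
open import Data.Fin.Subset using (Subset; _∈_; _∩_; ∣_∣)
open import Data.Fin.Subset.Properties using (_∈?_)
open import Data.Product using (Σ; _×_; _,_)
open import Data.Sum using (_⊎_)
open import Relation.Nullary using (¬_; Dec; yes; no)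
open import Relation.Binary.PropositionalEquality using (_≡_)
open import Function.Definitions using (Injective)

countFin : (m : ℕ) → {P : Fin m → Set} → ((i : Fin m) → Dec (P i)) → ℕ
countFin zero    P? = 0
countFin (suc m) P? with P? zero
... | yes _ = suc (countFin m (λ i → P? (suc i)))
... | no  _ = countFin m (λ i → P? (suc i))

-- A k-uniform hypergraph on vertex set Fin n with m edges, given as an
-- injective family of edges (so no repeated edges), each a k-subset.
record Hypergraph (k n : ℕ) : Set where
  field
    m        : ℕ
    edge     : Fin m → Subset n
    edge-inj : Injective _≡_ _≡_ edge
    uniform  : (i : Fin m) → ∣ edge i ∣ ≡ k

open Hypergraph public

Linear : {k n : ℕ} → Hypergraph k n → Set
Linear H = (i j : Fin (m H)) → ¬ (i ≡ j) → ∣ edge H i ∩ edge H j ∣ ≤ 1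

degree : {k n : ℕ} → Hypergraph k n → Fin n → ℕ
degree H v = countFin (m H) (λ i → v ∈? edge H i)

NearlyRegular : {k n : ℕ} → ℕ → Hypergraph k n → Set
NearlyRegular {k} {n} d H =
  ((v : Fin n) → (degree H v ≡ d) ⊎ (degree H v ≡ d ∸ 1))
  × countFin n (λ v → degree H v Data.Nat.≟ (d ∸ 1)) < k

module Submission where

-- Write K = k^d and n = q·K + r with r < K; for n ≥ d·K·K we have q ≥ r·d.
-- Take q disjoint copies of the grid [k]^d, whose lines (k points varying in
-- one coordinate) form a linear d-regular k-uniform hypergraph, and r extra
-- "hub" vertices.  Make r·d of the copies special, indexed by (i , j₀): in
-- copy (i , j₀) the line in direction j₀ through the origin takes hub i in
-- place of the origin.  Now each hub has degree d and the r·d origins of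
-- special copies have degree d - 1; these origins are grouped into
-- ⌊r·d / k⌋ new "patch" edges of size k, leaving (r·d mod k) < k of them
-- deficient.  Linearity survives because a patch meets each copy only in its
-- origin and a hub meets each copy only once.

open import Defs
open import Data.Bool using (true; false)
open import Data.Empty using (⊥; ⊥-elim)
open import Data.Fin using (Fin; zero; suc; punchIn; punchOut; _≟_)
open import Data.Fin.Properties
  using (injective⇒≤; suc-injective; +↔⊎; *↔×; punchIn-injective; punchIn-punchOut; punchInᵢ≢i)
open import Data.Fin.Subset using (Subset; _∈_; _∩_; ∣_∣)
open import Data.Fin.Subset.Properties using (_∈?_; drop-there; x∈p∩q⁻)
open import Data.Nat using (ℕ; zero; suc; _+_; _*_; _^_; _/_; _%_; _∸_; _≤_; _<_; _≥_; s≤s; NonZero)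
open import Data.Nat.DivMod using (m≡m%n+[m/n]*n; m%n<n; m*n/n≡m; /-monoˡ-≤)
open import Data.Nat.Properties
  using (≤-antisym; ≤-<-trans; 1+n≢n; m+[n∸m]≡n; *-monoˡ-≤; <⇒≤; *-comm; +-comm; m^n≢0; module ≤-Reasoning)
open import Data.Product using (Σ; ∃-syntax; _×_; _,_; proj₁; proj₂)
open import Data.Product.Function.NonDependent.Propositional using (_×-↔_)
import Data.Product.Properties as Productₚ
open import Data.Sum using (_⊎_; inj₁; inj₂)
import Data.Sum as Sum
open import Data.Sum.Function.Propositional using (_⊎-↔_)
import Data.Sum.Properties as Sumₚ
open import Data.Vec using (Vec; []; _∷_; there; lookup; tabulate; replicate; insertAt; removeAt)
open import Data.Vec.Properties
  using (lookup∘tabulate; []=⇒lookup; lookup⇒[]=; tabulate∘lookup; tabulate-cong; insertAt-lookup;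
         insertAt-removeAt; removeAt-insertAt; removeAt-punchOut; lookup-replicate)
import Data.Vec.Properties as Vecₚ
open import Function.Bundles using (_↔_; Inverse; Injection; mk↔ₛ′)
open import Function.Definitions using (Injective)
open import Function.Properties.Inverse using (↔-refl; ↔-sym; ↔-trans; ↔⇒↣)
open import Relation.Binary.Definitions using (DecidableEquality)
open import Relation.Binary.PropositionalEquality
  using (_≡_; _≢_; refl; sym; trans; cong; subst; module ≡-Reasoning)
open import Relation.Nullary using (¬_; Dec; yes; no; does)
open import Relation.Nullary.Decidable using (dec-true; _×-dec_; ¬?)

-- Counting.  `select m P?` lists the elements of Fin m satisfying P in
-- increasing order; the next three lemmas say it is an injective enumeration
-- of exactly those elements, which is how countFin is compared with maps.

private
  tail? : {m : ℕ} {P : Fin (suc m) → Set} → ((i : Fin (suc m)) → Dec (P i)) →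
          (i : Fin m) → Dec (P (suc i))
  tail? P? i = P? (suc i)

select : (m : ℕ) {P : Fin m → Set} (P? : (i : Fin m) → Dec (P i)) →
         Fin (countFin m P?) → Fin m
select (suc m) P? c with P? zero
select (suc m) P? zero    | yes _ = zero
select (suc m) P? (suc c) | yes _ = suc (select m (tail? P?) c)
select (suc m) P? c       | no  _ = suc (select m (tail? P?) c)

select-satisfies : (m : ℕ) {P : Fin m → Set} (P? : (i : Fin m) → Dec (P i)) →
                   (c : Fin (countFin m P?)) → P (select m P? c)
select-satisfies (suc m) P? c with P? zero
select-satisfies (suc m) P? zero    | yes p = p
select-satisfies (suc m) P? (suc c) | yes _ = select-satisfies m (tail? P?) c
select-satisfies (suc m) P? c       | no  _ = select-satisfies m (tail? P?) c

select-injective : (m : ℕ) {P : Fin m → Set} (P? : (i : Fin m) → Dec (P i)) →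
                   Injective _≡_ _≡_ (select m P?)
select-injective (suc m) P? {c} {c'} eq with P? zero
select-injective (suc m) P? {zero}  {zero}   eq | yes _ = refl
select-injective (suc m) P? {suc c} {suc c'} eq | yes _ =
  cong suc (select-injective m (tail? P?) (suc-injective eq))
select-injective (suc m) P? {c}     {c'}     eq | no  _ =
  select-injective m (tail? P?) (suc-injective eq)

select-complete : (m : ℕ) {P : Fin m → Set} (P? : (i : Fin m) → Dec (P i)) →
                  (i : Fin m) → P i → ∃[ c ] select m P? c ≡ i
select-complete (suc m) P? i p with P? zero
select-complete (suc m) P? zero    p | yes _  = zero , refl
select-complete (suc m) P? (suc i) p | yes _  =
  let c , eq = select-complete m (tail? P?) i p in suc c , cong suc eq
select-complete (suc m) P? zero    p | no ¬p0 = ⊥-elim (¬p0 p)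
select-complete (suc m) P? (suc i) p | no  _  =
  let c , eq = select-complete m (tail? P?) i p in c , cong suc eq

countFin-≤-cover : {m t : ℕ} {P : Fin m → Set} (P? : (i : Fin m) → Dec (P i))
                   (g : Fin t → Fin m) → ((i : Fin m) → P i → ∃[ a ] g a ≡ i) →
                   countFin m P? ≤ t
countFin-≤-cover {m} {t} P? g cover = injective⇒≤ {f = preimage} preimage-injective
  where
  preimage : Fin (countFin m P?) → Fin t
  preimage c = proj₁ (cover (select m P? c) (select-satisfies m P? c))

  hits : (c : Fin (countFin m P?)) → g (preimage c) ≡ select m P? c
  hits c = proj₂ (cover (select m P? c) (select-satisfies m P? c))

  preimage-injective : Injective _≡_ _≡_ preimage
  preimage-injective {c} {c'} eq =
    select-injective m P? (trans (sym (hits c)) (trans (cong g eq) (hits c')))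

≤-countFin-injection : {m t : ℕ} {P : Fin m → Set} (P? : (i : Fin m) → Dec (P i))
                       (f : Fin t → Fin m) → Injective _≡_ _≡_ f →
                       ((a : Fin t) → P (f a)) → t ≤ countFin m P?
≤-countFin-injection {m} {t} P? f f-injective f-sound = injective⇒≤ {f = position} position-injective
  where
  position : Fin t → Fin (countFin m P?)
  position a = proj₁ (select-complete m P? (f a) (f-sound a))

  selects : (a : Fin t) → select m P? (position a) ≡ f a
  selects a = proj₂ (select-complete m P? (f a) (f-sound a))

  position-injective : Injective _≡_ _≡_ position
  position-injective {a} {a'} eq =
    f-injective (trans (sym (selects a)) (trans (cong (select m P?) eq) (selects a')))

countFin-≤1 : {m : ℕ} {P : Fin m → Set} (P? : (i : Fin m) → Dec (P i)) →
              ((i j : Fin m) → P i → P j → i ≡ j) → countFin m P? ≤ 1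
countFin-≤1 {m} P? unique = injective⇒≤ {f = λ (_ : Fin (countFin m P?)) → zero {0}}
  (λ {c} {c'} _ → select-injective m P?
     (unique _ _ (select-satisfies m P? c) (select-satisfies m P? c')))

countFin-cong : (m : ℕ) {P Q : Fin m → Set}
                (P? : (i : Fin m) → Dec (P i)) (Q? : (i : Fin m) → Dec (Q i)) →
                ((i : Fin m) → P i → Q i) → ((i : Fin m) → Q i → P i) →
                countFin m P? ≡ countFin m Q?
countFin-cong zero    P? Q? P⇒Q Q⇒P = refl
countFin-cong (suc m) P? Q? P⇒Q Q⇒P with P? zero | Q? zero
... | yes _ | yes _  = cong suc (countFin-cong m _ _ (λ i → P⇒Q (suc i)) (λ i → Q⇒P (suc i)))
... | no  _ | no  _  = countFin-cong m _ _ (λ i → P⇒Q (suc i)) (λ i → Q⇒P (suc i))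
... | yes p | no ¬q  = ⊥-elim (¬q (P⇒Q zero p))
... | no ¬p | yes q  = ⊥-elim (¬p (Q⇒P zero q))

∣p∣≡countFin : {n : ℕ} (p : Subset n) → ∣ p ∣ ≡ countFin n (_∈? p)
∣p∣≡countFin []          = refl
∣p∣≡countFin (true ∷ p)  = cong suc (trans (∣p∣≡countFin p)
  (countFin-cong _ (_∈? p) _ (λ _ → there) (λ _ → drop-there)))
∣p∣≡countFin (false ∷ p) = trans (∣p∣≡countFin p)
  (countFin-cong _ (_∈? p) _ (λ _ → there) (λ _ → drop-there))

record Enumeration {A : Set} (P : A → Set) (t : ℕ) : Set where
  field
    elem      : Fin t → A
    injective : Injective _≡_ _≡_ elem
    sound     : (a : Fin t) → P (elem a)
    complete  : (x : A) → P x → ∃[ a ] elem a ≡ x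

countFin-enumeration : {m t : ℕ} {P : Fin m → Set} (P? : (i : Fin m) → Dec (P i)) →
                       Enumeration P t → countFin m P? ≡ t
countFin-enumeration P? e = ≤-antisym (countFin-≤-cover P? elem complete)
                                      (≤-countFin-injection P? elem injective sound)
  where open Enumeration e

transport-enumeration : {A B : Set} {P : A → Set} {Q : B → Set} {t : ℕ} (iso : A ↔ B) →
  ((x : A) → P x → Q (Inverse.to iso x)) → ((y : B) → Q y → P (Inverse.from iso y)) →
  Enumeration P t → Enumeration Q t
transport-enumeration {P = P} {Q} iso P⇒Q Q⇒P e = record
  { elem      = λ a → to (elem a)
  ; injective = λ eq → injective (Injection.injective (↔⇒↣ iso) eq)
  ; sound     = λ a → P⇒Q (elem a) (sound a)
  ; complete  = λ y q → let a , eq = complete (from y) (Q⇒P y q)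
                        in a , trans (cong to eq) (strictlyInverseˡ y)
  }
  where
  open Enumeration e
  open Inverse iso

subsetOf : {n : ℕ} {P : Fin n → Set} → ((x : Fin n) → Dec (P x)) → Subset n
subsetOf P? = tabulate (λ x → does (P? x))

∈-subsetOf⁻ : {n : ℕ} {P : Fin n → Set} (P? : (x : Fin n) → Dec (P x)) {x : Fin n} →
              x ∈ subsetOf P? → P x
∈-subsetOf⁻ P? {x} x∈ = witness (P? x) (trans (sym (lookup∘tabulate _ x)) ([]=⇒lookup x∈))
  where
  witness : {A : Set} (a? : Dec A) → does a? ≡ true → A
  witness (yes a) _ = a

∈-subsetOf⁺ : {n : ℕ} {P : Fin n → Set} (P? : (x : Fin n) → Dec (P x)) {x : Fin n} →
              P x → x ∈ subsetOf P?
∈-subsetOf⁺ P? {x} p = lookup⇒[]= x _ (trans (lookup∘tabulate _ x) (dec-true (P? x) p))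

-- A blueprint of a linear nearly-d-regular k-uniform hypergraph on n vertices:
-- vertices and edges are arbitrary finite types with a decidable incidence
-- relation, and uniformity and degrees are given by explicit enumerations
-- rather than by counting.  `Realise.realisation` turns it into a linear
-- nearly-d-regular `Hypergraph k n`.
record Blueprint (k n d : ℕ) : Set₁ where
  field
    Vertex   : Set
    Edge     : Set
    vertices : Vertex ↔ Fin n
    size     : ℕ
    edges    : Edge ↔ Fin size
    _on_     : Vertex → Edge → Set
    _on?_    : (v : Vertex) (e : Edge) → Dec (v on e)
    members  : (e : Edge) → Enumeration (_on e) k
    linear   : {e e' : Edge} {v w : Vertex} → e ≢ e' →
               v on e → v on e' → w on e → w on e' → v ≡ w
    degreeOf   : Vertex → ℕ
    incidences : (v : Vertex) → Enumeration (v on_) (degreeOf v)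
    nearly     : (v : Vertex) → degreeOf v ≡ d ⊎ degreeOf v ≡ d ∸ 1
    deficiency          : ℕ
    deficiency<k        : deficiency < k
    deficient           : Fin deficiency → Vertex
    deficient-complete  : (v : Vertex) → degreeOf v ≡ d ∸ 1 → ∃[ a ] deficient a ≡ v

two-positions : {k : ℕ} → k ≥ 2 → Σ (Fin k) (λ a → Σ (Fin k) (λ b → a ≢ b))
two-positions (s≤s (s≤s _)) = zero , suc zero , λ ()

module Realise {k n d : ℕ} (B : Blueprint k n d) (k≥2 : k ≥ 2) where
  open Blueprint B
  open Inverse vertices using () renaming (to to vIndex; from to vertex;
    strictlyInverseˡ to vIndex-vertex; strictlyInverseʳ to vertex-vIndex)
  open Inverse edges using () renaming (to to eIndex; from to edgeAt;
    strictlyInverseʳ to edgeAt-eIndex)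

  lies-on? : (i : Fin size) (x : Fin n) → Dec (vertex x on edgeAt i)
  lies-on? i x = vertex x on? edgeAt i

  edgeSet : Fin size → Subset n
  edgeSet i = subsetOf (lies-on? i)

  on⇒∈ : {x : Fin n} {i : Fin size} → vertex x on edgeAt i → x ∈ edgeSet i
  on⇒∈ {i = i} = ∈-subsetOf⁺ (lies-on? i)

  ∈⇒on : {x : Fin n} {i : Fin size} → x ∈ edgeSet i → vertex x on edgeAt i
  ∈⇒on {i = i} = ∈-subsetOf⁻ (lies-on? i)

  on⇒vIndex∈ : {v : Vertex} {i : Fin size} → v on edgeAt i → vIndex v ∈ edgeSet i
  on⇒vIndex∈ {v} v-on = on⇒∈ (subst (_on _) (sym (vertex-vIndex v)) v-on)

  edgeSet-uniform : (i : Fin size) → ∣ edgeSet i ∣ ≡ k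
  edgeSet-uniform i = trans (∣p∣≡countFin (edgeSet i)) (countFin-enumeration _
    (transport-enumeration vertices (λ _ → on⇒vIndex∈) (λ _ → ∈⇒on) (members (edgeAt i))))

  edgeAt-injective : Injective _≡_ _≡_ edgeAt
  edgeAt-injective = Injection.injective (↔⇒↣ (↔-sym edges))

  edgeSet-linear : (i j : Fin size) → i ≢ j → ∣ edgeSet i ∩ edgeSet j ∣ ≤ 1
  edgeSet-linear i j i≢j =
    subst (_≤ 1) (sym (∣p∣≡countFin (edgeSet i ∩ edgeSet j))) (countFin-≤1 _ common-unique)
    where
    common-unique : (x y : Fin n) → x ∈ edgeSet i ∩ edgeSet j → y ∈ edgeSet i ∩ edgeSet j → x ≡ y
    common-unique x y x∈ y∈ =
      let x∈i , x∈j = x∈p∩q⁻ (edgeSet i) (edgeSet j) x∈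
          y∈i , y∈j = x∈p∩q⁻ (edgeSet i) (edgeSet j) y∈
      in  trans (sym (vIndex-vertex x)) (trans (cong vIndex
            (linear (λ eq → i≢j (edgeAt-injective eq)) (∈⇒on x∈i) (∈⇒on x∈j) (∈⇒on y∈i) (∈⇒on y∈j)))
            (vIndex-vertex y))

  -- Distinct edges have distinct vertex sets: they share at most one vertex
  -- but each has k ≥ 2 of them.
  edgeSet-injective : Injective _≡_ _≡_ edgeSet
  edgeSet-injective {i} {j} eq with i ≟ j
  ... | yes i≡j = i≡j
  ... | no  i≢j = ⊥-elim (a≢b (injective
          (linear (λ eq′ → i≢j (edgeAt-injective eq′)) (sound a) (on-j a) (sound b) (on-j b))))
    where
    open Enumeration (members (edgeAt i))
    a b : Fin k
    a = proj₁ (two-positions k≥2)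
    b = proj₁ (proj₂ (two-positions k≥2))
    a≢b : a ≢ b
    a≢b = proj₂ (proj₂ (two-positions k≥2))
    on-j : (c : Fin k) → elem c on edgeAt j
    on-j c = subst (_on _) (vertex-vIndex (elem c))
               (∈⇒on (subst (vIndex (elem c) ∈_) eq (on⇒vIndex∈ (sound c))))

  hypergraph : Hypergraph k n
  hypergraph = record { m = size ; edge = edgeSet ; edge-inj = edgeSet-injective ; uniform = edgeSet-uniform }

  degree-vertex : (x : Fin n) → degree hypergraph x ≡ degreeOf (vertex x)
  degree-vertex x = countFin-enumeration _
    (transport-enumeration edges
      (λ e on-e → on⇒∈ (subst (vertex x on_) (sym (edgeAt-eIndex e)) on-e)) (λ _ → ∈⇒on)
      (incidences (vertex x)))

  nearlyRegular : NearlyRegular d hypergraph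
  nearlyRegular = (λ x → Sum.map (trans (degree-vertex x)) (trans (degree-vertex x)) (nearly (vertex x)))
                , ≤-<-trans (countFin-≤-cover _ (λ a → vIndex (deficient a)) cover) deficiency<k
    where
    cover : (x : Fin n) → degree hypergraph x ≡ d ∸ 1 → ∃[ a ] vIndex (deficient a) ≡ x
    cover x deg≡ = let a , eq = deficient-complete (vertex x) (trans (sym (degree-vertex x)) deg≡)
                   in a , trans (cong vIndex eq) (vIndex-vertex x)

  realisation : Σ (Hypergraph k n) (λ H → Linear H × NearlyRegular d H)
  realisation = hypergraph , edgeSet-linear , nearlyRegular

product↔ : {A B : Set} {a b : ℕ} → Fin a ↔ A → Fin b ↔ B → Fin (a * b) ↔ (A × B)
product↔ f g = ↔-trans *↔× (f ×-↔ g)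

sum↔ : {A B : Set} {a b : ℕ} → Fin a ↔ A → Fin b ↔ B → Fin (a + b) ↔ (A ⊎ B)
sum↔ f g = ↔-trans +↔⊎ (f ⊎-↔ g)

Fin^↔Vec : (k d : ℕ) → Fin (k ^ d) ↔ Vec (Fin k) d
Fin^↔Vec k zero    = mk↔ₛ′ (λ _ → []) (λ _ → zero) (λ { [] → refl }) (λ { zero → refl })
Fin^↔Vec k (suc d) = ↔-trans (product↔ ↔-refl (Fin^↔Vec k d)) cons
  where
  cons : (Fin k × Vec (Fin k) d) ↔ Vec (Fin k) (suc d)
  cons = mk↔ₛ′ (λ (x , xs) → x ∷ xs) (λ { (x ∷ xs) → x , xs })
               (λ { (x ∷ xs) → refl }) (λ { (x , xs) → refl })

lookup-extensional : {A : Set} {n : ℕ} (p q : Vec A n) →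
                     ((t : Fin n) → lookup p t ≡ lookup q t) → p ≡ q
lookup-extensional p q same = trans (sym (tabulate∘lookup p))
                                (trans (tabulate-cong same) (tabulate∘lookup q))

-- Two grid lines in different directions meet in at most one point: a vector
-- is determined by its deletions at two distinct coordinates.
removeAt-two-injective : {A : Set} {n : ℕ} (p q : Vec A (suc n)) {j j' : Fin (suc n)} → j ≢ j' →
                         removeAt p j ≡ removeAt q j → removeAt p j' ≡ removeAt q j' → p ≡ q
removeAt-two-injective {n = n} p q {j} {j'} j≢j' eq eq′ = lookup-extensional p q same
  where
  via : (i : Fin (suc n)) → removeAt p i ≡ removeAt q i →
        (t : Fin (suc n)) → i ≢ t → lookup p t ≡ lookup q t
  via i eqᵢ t i≢t = trans (sym (removeAt-punchOut p i≢t))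
                      (trans (cong (λ z → lookup z (punchOut i≢t)) eqᵢ) (removeAt-punchOut q i≢t))
  same : (t : Fin (suc n)) → lookup p t ≡ lookup q t
  same t with j ≟ t
  ... | no  j≢t  = via j eq t j≢t
  ... | yes refl = via j' eq′ t (λ j'≡j → j≢j' (sym j'≡j))

insertAt-injective : {A : Set} {n : ℕ} (w : Vec A n) (j : Fin (suc n)) {x y : A} →
                     insertAt w j x ≡ insertAt w j y → x ≡ y
insertAt-injective w j {x} {y} eq = trans (sym (insertAt-lookup w j x))
                                      (trans (cong (λ z → lookup z j) eq) (insertAt-lookup w j y))

insertAt-removeAt′ : {A : Set} {n : ℕ} (p : Vec A (suc n)) (j : Fin (suc n)) {w : Vec A n} {x : A} →
                     removeAt p j ≡ w → lookup p j ≡ x → insertAt w j x ≡ p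
insertAt-removeAt′ p j refl refl = insertAt-removeAt p j

module Construction (k' d' r M : ℕ) where
  k d : ℕ
  k = suc k'
  d = suc d'

  -- points of the grid [k]^d, and rows: a line in direction j through the
  -- row w consists of the points insertAt w j x for x : Fin k
  Box Row : Set
  Box = Vec (Fin k) d
  Row = Vec (Fin k) d'

  origin : Box
  origin = replicate d zero

  _≟ᵛ_ : {m : ℕ} → DecidableEquality (Vec (Fin k) m)
  _≟ᵛ_ = Vecₚ.≡-dec _≟_

  Copy : Set
  Copy = (Fin r × Fin d) ⊎ Fin M

  pattern special i j₀ = inj₁ (i , j₀)
  pattern ordinary a   = inj₂ a

  _≟ᶜ_ : DecidableEquality Copy
  _≟ᶜ_ = Sumₚ.≡-dec (Productₚ.≡-dec _≟_ _≟_) _≟_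

  Vertex : Set
  Vertex = (Copy × Box) ⊎ Fin r

  pattern cell c p = inj₁ (c , p)
  pattern hub i    = inj₂ i

  -- The r·d origins of special copies are dealt out into F patch edges of
  -- size k, leaving L < k of them over.
  F L : ℕ
  F = (r * d) / k
  L = (r * d) % k

  Slot : Set
  Slot = Fin L ⊎ (Fin F × Fin k)

  pattern leftover a = inj₁ a
  pattern seat x a   = inj₂ (x , a)

  slots : (Fin r × Fin d) ↔ Slot
  slots = ↔-trans (↔-sym *↔×) (↔-trans cast (sum↔ ↔-refl *↔×))
    where
    cast : Fin (r * d) ↔ Fin (L + F * k)
    cast = subst (λ t → Fin (r * d) ↔ Fin t) (m≡m%n+[m/n]*n (r * d) k) ↔-refl

  open Inverse slots using () renaming (to to slotOf; from to owner;
    strictlyInverseˡ to slotOf-owner; strictlyInverseʳ to owner-slotOf)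

  Edge : Set
  Edge = (Copy × Fin d × Row) ⊎ Fin F

  pattern line c j w = inj₁ (c , j , w)
  pattern patch x    = inj₂ x

  -- In special copy (i , j₀) the line in direction j₀ through the origin
  -- passes through hub i instead of the origin.
  Rerouted : Copy → Fin d → Box → Set
  Rerouted (special i j₀) j p = (j ≡ j₀) × (p ≡ origin)
  Rerouted (ordinary a)   j p = ⊥

  rerouted? : (c : Copy) (j : Fin d) (p : Box) → Dec (Rerouted c j p)
  rerouted? (special i j₀) j p = (j ≟ j₀) ×-dec (p ≟ᵛ origin)
  rerouted? (ordinary a)   j p = no (λ ())

  SeatOf : Fin F → Slot → Set
  SeatOf x (leftover _) = ⊥
  SeatOf x (seat x' _)  = x' ≡ x

  seatOf? : (x : Fin F) (z : Slot) → Dec (SeatOf x z)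
  seatOf? x (leftover _) = no (λ ())
  seatOf? x (seat x' _)  = x' ≟ x

  InPatch : Fin F → Copy → Set
  InPatch x (special i j₀) = SeatOf x (slotOf (i , j₀))
  InPatch x (ordinary a)   = ⊥

  inPatch? : (x : Fin F) (c : Copy) → Dec (InPatch x c)
  inPatch? x (special i j₀) = seatOf? x (slotOf (i , j₀))
  inPatch? x (ordinary a)   = no (λ ())

  infix 4 _on_ _on?_
  _on_ : Vertex → Edge → Set
  cell c p on line c' j w = (c' ≡ c) × (removeAt p j ≡ w) × ¬ Rerouted c j p
  hub i    on line c j w  = (c ≡ special i j) × (w ≡ removeAt origin j)
  cell c p on patch x     = (p ≡ origin) × InPatch x c
  hub i    on patch x     = ⊥

  _on?_ : (v : Vertex) (e : Edge) → Dec (v on e)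
  cell c p on? line c' j w = (c' ≟ᶜ c) ×-dec (removeAt p j ≟ᵛ w) ×-dec ¬? (rerouted? c j p)
  hub i    on? line c j w  = (c ≟ᶜ special i j) ×-dec (w ≟ᵛ removeAt origin j)
  cell c p on? patch x     = (p ≟ᵛ origin) ×-dec inPatch? x c
  hub i    on? patch x     = no (λ ())

  pointOf : (c : Copy) (j : Fin d) (p : Box) → Dec (Rerouted c j p) → Vertex
  pointOf (special i j₀) j p (yes _) = hub i
  pointOf (special i j₀) j p (no _)  = cell (special i j₀) p
  pointOf (ordinary a)   j p _       = cell (ordinary a) p

  pointOf-on : (c : Copy) (j : Fin d) (p : Box) (rr? : Dec (Rerouted c j p)) {w : Row} →
               removeAt p j ≡ w → pointOf c j p rr? on line c j w
  pointOf-on (special i j₀) j p (yes (refl , refl)) refl = refl , refl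
  pointOf-on (special i j₀) j p (no ¬rr)            eq   = refl , eq , ¬rr
  pointOf-on (ordinary a)   j p _                   eq   = refl , eq , λ ()

  pointOf-injective : (c : Copy) (j : Fin d) {p q : Box}
                      (rr? : Dec (Rerouted c j p)) (rr?′ : Dec (Rerouted c j q)) →
                      pointOf c j p rr? ≡ pointOf c j q rr?′ → p ≡ q
  pointOf-injective (special i j₀) j (yes (_ , p≡o)) (yes (_ , q≡o)) _ = trans p≡o (sym q≡o)
  pointOf-injective (special i j₀) j (no _) (no _) refl = refl
  pointOf-injective (ordinary a)   j _      _      refl = refl

  pointOf-cell : (c : Copy) (j : Fin d) (p : Box) → ¬ Rerouted c j p →
                 (rr? : Dec (Rerouted c j p)) → pointOf c j p rr? ≡ cell c p
  pointOf-cell (special i j₀) j p ¬rr (yes rr) = ⊥-elim (¬rr rr)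
  pointOf-cell (special i j₀) j p ¬rr (no _)   = refl
  pointOf-cell (ordinary a)   j p ¬rr _        = refl

  pointOf-hub : (i : Fin r) (j₀ j : Fin d) (p : Box) → Rerouted (special i j₀) j p →
                (rr? : Dec (Rerouted (special i j₀) j p)) → pointOf (special i j₀) j p rr? ≡ hub i
  pointOf-hub i j₀ j p rr (yes _)  = refl
  pointOf-hub i j₀ j p rr (no ¬rr) = ⊥-elim (¬rr rr)

  insertAt-origin : (j : Fin d) → insertAt (removeAt origin j) j zero ≡ origin
  insertAt-origin j = insertAt-removeAt′ origin j refl (lookup-replicate j zero)

  lineMembers : (c : Copy) (j : Fin d) (w : Row) → Enumeration (_on line c j w) k
  lineMembers c j w = record
    { elem      = member
    ; injective = λ eq → insertAt-injective w j (pointOf-injective c j _ _ eq)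
    ; sound     = λ x → pointOf-on c j _ _ (removeAt-insertAt w j x)
    ; complete  = complete
    }
    where
    member : Fin k → Vertex
    member x = pointOf c j (insertAt w j x) (rerouted? c j (insertAt w j x))

    complete : (v : Vertex) → v on line c j w → ∃[ x ] member x ≡ v
    complete (cell .c p) (refl , removed , ¬rr) =
      lookup p j , trans (pointOf-cell c j _ (subst (λ q → ¬ Rerouted c j q) (sym restored) ¬rr) _)
                         (cong (cell c) restored)
      where
      restored : insertAt w j (lookup p j) ≡ p
      restored = insertAt-removeAt′ p j removed refl
    complete (hub i) (refl , refl) = zero , pointOf-hub i j j _ (refl , insertAt-origin j) _

  patchMembers : (x : Fin F) → Enumeration (_on patch x) k
  patchMembers x = record
    { elem      = member
    ; injective = injective
    ; sound     = λ a → refl , subst (SeatOf x) (sym (slotOf-owner (seat x a))) refl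
    ; complete  = complete
    }
    where
    member : Fin k → Vertex
    member a = cell (inj₁ (owner (seat x a))) origin

    injective : {a a' : Fin k} → member a ≡ member a' → a ≡ a'
    injective {a} {a'} eq = seat-injective
      (Injection.injective (↔⇒↣ (↔-sym slots)) {seat x a} {seat x a'} (origin-injective eq))
      where
      origin-injective : {s s' : Fin r × Fin d} → cell (inj₁ s) origin ≡ cell (inj₁ s') origin → s ≡ s'
      origin-injective refl = refl
      seat-injective : {b b' : Fin k} → seat x b ≡ seat x b' → b ≡ b'
      seat-injective refl = refl

    complete : (v : Vertex) → v on patch x → ∃[ a ] member a ≡ v
    complete (cell (special i j₀) p) (refl , seated) with slotOf (i , j₀) in eq | seated
    ... | seat .x a | refl = a , cong (λ s → cell (inj₁ s) origin)
                                   (trans (cong owner (sym eq)) (owner-slotOf (i , j₀)))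

  -- Two lines of one copy in the same direction are disjoint and
  -- in different directions meet in at most one grid point; a hub lies on
  -- one line of each of d different copies; distinct patches are disjoint;
  -- a patch meets a line of copy c only at the origin of c.
  lines-linear : {c c' : Copy} {j j' : Fin d} {w w' : Row} (u v : Vertex) →
                 _≢_ {A = Edge} (line c j w) (line c' j' w') → u on line c j w → u on line c' j' w' →
                 v on line c j w → v on line c' j' w' → u ≡ v
  lines-linear {j = j} {j'} (cell _ p) (cell _ q) ne
               (refl , p₁ , _) (refl , p₂ , _) (refl , q₁ , _) (refl , q₂ , _) with j ≟ j'
  ... | no  j≢j' = cong (cell _) (removeAt-two-injective p q j≢j' (trans p₁ (sym q₁)) (trans p₂ (sym q₂)))
  ... | yes refl with trans (sym p₁) p₂
  ...   | refl = ⊥-elim (ne refl)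
  lines-linear (hub i) (hub .i) ne (refl , _) _ (refl , _) _ = refl
  lines-linear (hub i) (cell _ q) ne (refl , refl) (refl , refl) (refl , _) (refl , _) = ⊥-elim (ne refl)
  lines-linear (cell _ p) (hub i) ne (refl , _) (refl , _) (refl , refl) (refl , refl) = ⊥-elim (ne refl)

  seat-unique : (z : Slot) {x x' : Fin F} → SeatOf x z → SeatOf x' z → x ≡ x'
  seat-unique (seat _ _) refl refl = refl

  patches-disjoint : {x x' : Fin F} (u : Vertex) → _≢_ {A = Edge} (patch x) (patch x') →
                     u on patch x → u on patch x' → ⊥
  patches-disjoint (cell (special i j₀) _) ne (_ , seated) (_ , seated′)
    with seat-unique (slotOf (i , j₀)) seated seated′
  ... | refl = ne refl

  patch-line-meet : {x : Fin F} {c : Copy} {j : Fin d} {w : Row} (u : Vertex) →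
                    u on patch x → u on line c j w → u ≡ cell c origin
  patch-line-meet (cell _ _) (refl , _) (refl , _) = refl

  linear : {e e' : Edge} {u v : Vertex} → e ≢ e' → u on e → u on e' → v on e → v on e' → u ≡ v
  linear {line _ _ _} {line _ _ _} {u} {v} ne = lines-linear u v ne
  linear {patch _}    {patch _}    {u}     ne u₁ u₂ _ _ = ⊥-elim (patches-disjoint u ne u₁ u₂)
  linear {patch _}    {line _ _ _} {u} {v} ne u₁ u₂ v₁ v₂ =
    trans (patch-line-meet u u₁ u₂) (sym (patch-line-meet v v₁ v₂))
  linear {line _ _ _} {patch _}    {u} {v} ne u₁ u₂ v₁ v₂ =
    trans (patch-line-meet u u₂ u₁) (sym (patch-line-meet v v₂ v₁))

  -- Degrees.  Every vertex has degree d except the origins of special copies: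
  -- the origin of (i , j₀) is not on the rerouted line, and it regains an edge
  -- exactly when it is seated at a patch.
  originDegree : Slot → ℕ
  originDegree (leftover _) = d'
  originDegree (seat _ _)   = d

  cellDegree : (c : Copy) (p : Box) → Dec (p ≡ origin) → ℕ
  cellDegree (special i j₀) p (yes _) = originDegree (slotOf (i , j₀))
  cellDegree (special i j₀) p (no _)  = d
  cellDegree (ordinary a)   p _       = d

  degreeOf : Vertex → ℕ
  degreeOf (cell c p) = cellDegree c p (p ≟ᵛ origin)
  degreeOf (hub i)    = d

  direction-injective : {c c' : Copy} {j j' : Fin d} {w w' : Row} →
                        _≡_ {A = Edge} (line c j w) (line c' j' w') → j ≡ j'
  direction-injective refl = refl

  hubIncidences : (i : Fin r) → Enumeration (hub i on_) d
  hubIncidences i = record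
    { elem      = λ j → line (special i j) j (removeAt origin j)
    ; injective = direction-injective
    ; sound     = λ j → refl , refl
    ; complete  = λ { (line c j w) (refl , refl) → j , refl }
    }

  patch-rerouted : (c : Copy) {x : Fin F} → InPatch x c → ∃[ j ] Rerouted c j origin
  patch-rerouted (special i j₀) _ = j₀ , refl , refl

  straightIncidences : (c : Copy) (p : Box) → ((j : Fin d) → ¬ Rerouted c j p) →
                       Enumeration (cell c p on_) d
  straightIncidences c p ¬rr = record
    { elem      = λ j → line c j (removeAt p j)
    ; injective = direction-injective
    ; sound     = λ j → refl , refl , ¬rr j
    ; complete  = complete
    }
    where
    complete : (e : Edge) → cell c p on e → ∃[ j ] line c j (removeAt p j) ≡ e
    complete (line .c j _) (refl , refl , _) = j , refl
    complete (patch x) (refl , seated) =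
      let j , rr = patch-rerouted c seated in ⊥-elim (¬rr j rr)

  module Origin (i : Fin r) (j₀ : Fin d) where
    survivingLine : Fin d' → Edge
    survivingLine b = line (special i j₀) (punchIn j₀ b) (removeAt origin (punchIn j₀ b))

    survivingLine-sound : (b : Fin d') → cell (special i j₀) origin on survivingLine b
    survivingLine-sound b = refl , refl , λ (j≡j₀ , _) → punchInᵢ≢i j₀ b j≡j₀

    survivingLine-injective : Injective _≡_ _≡_ survivingLine
    survivingLine-injective eq = punchIn-injective j₀ _ _ (direction-injective eq)

    survivingLine-complete : (c : Copy) (j : Fin d) (w : Row) →
                             cell (special i j₀) origin on line c j w → ∃[ b ] survivingLine b ≡ line c j w
    survivingLine-complete c j w (refl , refl , ¬rr) with j₀ ≟ j
    ... | yes refl = ⊥-elim (¬rr (refl , refl))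
    ... | no j₀≢j  = punchOut j₀≢j , cong (λ t → line (special i j₀) t (removeAt origin t))
                                          (punchIn-punchOut j₀≢j)

    incidences : (z : Slot) → slotOf (i , j₀) ≡ z → Enumeration (cell (special i j₀) origin on_) (originDegree z)
    incidences (leftover a) eq = record
      { elem      = survivingLine
      ; injective = survivingLine-injective
      ; sound     = survivingLine-sound
      ; complete  = complete
      }
      where
      complete : (e : Edge) → cell (special i j₀) origin on e → ∃[ b ] survivingLine b ≡ e
      complete (line c j w) on-line = survivingLine-complete c j w on-line
      complete (patch x) (_ , seated) = ⊥-elim (subst (SeatOf x) eq seated)
    incidences (seat x a) eq = record
      { elem      = elem
      ; injective = injective
      ; sound     = sound
      ; complete  = complete
      }
      where
      elem : Fin d → Edge
      elem zero    = patch x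
      elem (suc b) = survivingLine b

      injective : Injective _≡_ _≡_ elem
      injective {zero}  {zero}   _  = refl
      injective {suc b} {suc b'} eq = cong suc (survivingLine-injective eq)

      sound : (b : Fin d) → cell (special i j₀) origin on elem b
      sound zero    = refl , subst (SeatOf x) (sym eq) refl
      sound (suc b) = survivingLine-sound b

      complete : (e : Edge) → cell (special i j₀) origin on e → ∃[ b ] elem b ≡ e
      complete (line c j w) on-line = let b , found = survivingLine-complete c j w on-line in suc b , found
      complete (patch x') (_ , seated) with subst (SeatOf x') eq seated
      ... | refl = zero , refl

  cellIncidences : (c : Copy) (p : Box) (o? : Dec (p ≡ origin)) →
                   Enumeration (cell c p on_) (cellDegree c p o?)
  cellIncidences (special i j₀) p (yes refl) = Origin.incidences i j₀ (slotOf (i , j₀)) refl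
  cellIncidences (special i j₀) p (no p≢o)   = straightIncidences (special i j₀) p (λ _ (_ , p≡o) → p≢o p≡o)
  cellIncidences (ordinary a)   p _          = straightIncidences (ordinary a) p (λ _ ())

  incidences : (v : Vertex) → Enumeration (v on_) (degreeOf v)
  incidences (cell c p) = cellIncidences c p (p ≟ᵛ origin)
  incidences (hub i)    = hubIncidences i

  cellDegree-nearly : (c : Copy) (p : Box) (o? : Dec (p ≡ origin)) →
                      cellDegree c p o? ≡ d ⊎ cellDegree c p o? ≡ d'
  cellDegree-nearly (special i j₀) p (yes _) with slotOf (i , j₀)
  ... | leftover _ = inj₂ refl
  ... | seat _ _   = inj₁ refl
  cellDegree-nearly (special i j₀) p (no _)  = inj₁ refl
  cellDegree-nearly (ordinary a)   p _       = inj₁ refl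

  nearly : (v : Vertex) → degreeOf v ≡ d ⊎ degreeOf v ≡ d ∸ 1
  nearly (cell c p) = cellDegree-nearly c p (p ≟ᵛ origin)
  nearly (hub i)    = inj₁ refl

  deficient : Fin L → Vertex
  deficient a = cell (inj₁ (owner (leftover a))) origin

  cell-deficient : (c : Copy) (p : Box) (o? : Dec (p ≡ origin)) → cellDegree c p o? ≡ d' →
                   ∃[ a ] deficient a ≡ cell c p
  cell-deficient (special i j₀) p (yes refl) deg≡ with slotOf (i , j₀) in eq
  ... | leftover a = a , cong (λ s → cell (inj₁ s) origin)
                              (trans (cong owner (sym eq)) (owner-slotOf (i , j₀)))
  ... | seat _ _   = ⊥-elim (1+n≢n deg≡)
  cell-deficient (special i j₀) p (no _) deg≡ = ⊥-elim (1+n≢n deg≡)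
  cell-deficient (ordinary a)   p _      deg≡ = ⊥-elim (1+n≢n deg≡)

  deficient-complete : (v : Vertex) → degreeOf v ≡ d ∸ 1 → ∃[ a ] deficient a ≡ v
  deficient-complete (cell c p) = cell-deficient c p (p ≟ᵛ origin)
  deficient-complete (hub i)    = λ deg≡ → ⊥-elim (1+n≢n deg≡)

  copies : Fin (r * d + M) ↔ Copy
  copies = sum↔ *↔× ↔-refl

  vertexCount edgeCount : ℕ
  vertexCount = (r * d + M) * k ^ d + r
  edgeCount   = (r * d + M) * (d * k ^ d') + F

  vertices : Vertex ↔ Fin vertexCount
  vertices = ↔-sym (sum↔ (product↔ copies (Fin^↔Vec k d)) ↔-refl)

  edges : Edge ↔ Fin edgeCount
  edges = ↔-sym (sum↔ (product↔ copies (product↔ ↔-refl (Fin^↔Vec k d'))) ↔-refl)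

  blueprint : Blueprint k vertexCount d
  blueprint = record
    { Vertex             = Vertex
    ; Edge               = Edge
    ; vertices           = vertices
    ; size               = edgeCount
    ; edges              = edges
    ; _on_               = _on_
    ; _on?_              = _on?_
    ; members            = λ { (line c j w) → lineMembers c j w ; (patch x) → patchMembers x }
    ; linear             = linear
    ; degreeOf           = degreeOf
    ; incidences         = incidences
    ; nearly             = nearly
    ; deficiency         = L
    ; deficiency<k       = m%n<n (r * d) k
    ; deficient          = deficient
    ; deficient-complete = deficient-complete
    }

room-for-special-copies : (d K n : ℕ) .{{_ : NonZero K}} → d * K * K ≤ n → n % K * d ≤ n / K
room-for-special-copies d K n large = begin
  n % K * d       ≤⟨ *-monoˡ-≤ d (<⇒≤ (m%n<n n K)) ⟩
  K * d           ≡⟨ *-comm K d ⟩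
  d * K           ≡⟨ m*n/n≡m (d * K) K ⟨
  d * K * K / K   ≤⟨ /-monoˡ-≤ K large ⟩
  n / K           ∎
  where open ≤-Reasoning

decomposition : (d K n : ℕ) .{{_ : NonZero K}} → d * K * K ≤ n →
                (n % K * d + (n / K ∸ n % K * d)) * K + n % K ≡ n
decomposition d K n large = begin
  (n % K * d + (n / K ∸ n % K * d)) * K + n % K ≡⟨ cong (λ q → q * K + n % K)
                                                     (m+[n∸m]≡n (room-for-special-copies d K n large)) ⟩
  n / K * K + n % K                             ≡⟨ +-comm (n / K * K) (n % K) ⟩
  n % K + n / K * K                             ≡⟨ m≡m%n+[m/n]*n n K ⟨
  n                                             ∎
  where open ≡-Reasoning

theorem1p5 : (d k : ℕ) → d ≥ 1 → k ≥ 2 →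
    Σ ℕ (λ n₀ → (n : ℕ) → n₀ ≤ n →
      Σ (Hypergraph k n) (λ H → Linear H × NearlyRegular d H))
theorem1p5 zero     _        ()  _
theorem1p5 (suc d') zero     _   ()
theorem1p5 (suc d') (suc k') _   k≥2 = suc d' * K * K , hypergraphOfSize
  where
  K : ℕ
  K = suc k' ^ suc d'

  instance
    K≢0 : NonZero K
    K≢0 = m^n≢0 (suc k') (suc d')

  hypergraphOfSize : (n : ℕ) → suc d' * K * K ≤ n →
                     Σ (Hypergraph (suc k') n) (λ H → Linear H × NearlyRegular (suc d') H)
  hypergraphOfSize n large =
    subst (λ size → Σ (Hypergraph (suc k') size) (λ H → Linear H × NearlyRegular (suc d') H))
          (decomposition (suc d') K n large)
          (Realise.realisation (Construction.blueprint k' d' r (n / K ∸ r * suc d')) k≥2)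
    where
    r : ℕ
    r = n % K
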